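{- Let $k,k'$ be integers with $1\le k\le k'$. Then for every graph $G$, $$\gamma_{k'{\rm rt}}(G)\le \frac{k'}{k}\gamma_{k{\rm rt}}(G)\quad\text{and}\quad \gamma_{{\rm r}k'}(G)\le \frac{k'}{k}\gamma_{{\rm r}k}(G).$$ Furthermore, both bounds hold with equality when $G=K_{a,b}$ with $a,b\ge 2k'$.
   Context: All graphs are finite, simple and undirected; $N(v)$ denotes the open neighborhood of $v$, and $[k]=\{1,\dots,k\}$. A $k$-rainbow dominating function ($k$RDF) of $G$ is a function $f:V(G)\to 2^{[k]}$ such that every vertex $v$ with $f(v)=\emptyset$ satisfies $\bigcup_{u\in N(v)}f(u)=[k]$. A $k$-rainbow total dominating function ($k$RTDF) is a $k$RDF $f$ such that additionally, for every vertex $v$ with $f(v)=\{i\}$ for some $i\in[k]$, there is $u\in N(v)$ with $i\in f(u)$. The weight of $f$ is $\|f\|=\sum_{v}|f(v)|$; $\gamma_{{\rm r}k}(G)$ and $\gamma_{k{\rm rt}}(G)$ are the minimum weights of a $k$RDF and a $k$RTDF of $G$, respectively (if no $k$RTDF exists, which happens only for $k=1$ and $G$ with an isolated vertex, $\gamma_{k{\rm rt}}(G)=\infty$). $K_{a,b}$ is the complete bipartite graph with parts of sizes $a$ and $b$. -}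

module Defs where

open import Data.Nat using (ℕ; _+_; _<ᵇ_)
open import Data.Bool using (Bool; true; false; _xor_)
open import Data.Bool.Properties using (xor-same)
open import Data.Fin using (Fin; toℕ)
open import Data.Fin.Subset using (Subset; _∈_; ⊥; ⁅_⁆; ∣_∣)
open import Data.List using (map; allFin)
open import Data.Nat.ListAction using (sum)
open import Data.Product using (Σ; ∃; _×_)
open import Relation.Binary.PropositionalEquality using (_≡_; refl)

record Graph : Set where
  field
    n     : ℕ
    adj   : Fin n → Fin n → Bool
    sym   : ∀ u v → adj u v ≡ adj v u
    irrefl : ∀ v → adj v v ≡ false
open Graph public

_~[_]_ : (G : Graph) → Fin (n G) → Fin (n G) → Set
_~[_]_ G v u = adj G v u ≡ true

Assignment : Graph → ℕ → Set
Assignment G k = Fin (n G) → Subset k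

IsRDF : (G : Graph) (k : ℕ) → Assignment G k → Set
IsRDF G k f = ∀ v → f v ≡ ⊥ → ∀ (i : Fin k) → ∃ λ u → (G ~[ v ] u) × (i ∈ f u)

IsRTDF : (G : Graph) (k : ℕ) → Assignment G k → Set
IsRTDF G k f = IsRDF G k f
             × (∀ v (i : Fin k) → f v ≡ ⁅ i ⁆ → ∃ λ u → (G ~[ v ] u) × (i ∈ f u))

weight : (G : Graph) (k : ℕ) → Assignment G k → ℕ
weight G k f = sum (map (λ v → ∣ f v ∣) (allFin (n G)))

IsMinWeight : (G : Graph) (k : ℕ) → (Assignment G k → Set) → ℕ → Set
IsMinWeight G k P m =
  (Σ (Assignment G k) λ f → P f × weight G k f ≡ m)
  × (∀ f → P f → m Data.Nat.≤ weight G k f)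

IsRainbowDomNumber : Graph → ℕ → ℕ → Set
IsRainbowDomNumber G k m = IsMinWeight G k (IsRDF G k) m

-- γ_{krt}(G) = m  (finite); γ_{krt}(G) = ∞ iff no such m exists
IsRainbowTotalDomNumber : Graph → ℕ → ℕ → Set
IsRainbowTotalDomNumber G k m = IsMinWeight G k (IsRTDF G k) m

private
  side : ∀ {a b} → Fin (a + b) → Bool
  side {a} x = toℕ x <ᵇ a

  xor-comm : ∀ x y → x xor y ≡ y xor x
  xor-comm true true = refl
  xor-comm true false = refl
  xor-comm false true = refl
  xor-comm false false = refl

K : ℕ → ℕ → Graph
K a b = record
  { n = a + b
  ; adj = λ u v → side {a} {b} u xor side {a} {b} v
  ; sym = λ u v → xor-comm (side {a} {b} u) (side {a} {b} v)
  ; irrefl = λ v → xor-same (side {a} {b} v)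
  }

module Submission where

-- Given a (total) rainbow dominating function f
-- with k colours, add a new colour that duplicates the least-used old
-- colour c.  Domination is preserved, and since c is used at most ‖f‖/k
-- times the weight grows to at most ((k+1)/k)‖f‖.  Iterating from k to k′
-- colours (the ratios telescope) turns an optimal k-colouring into a
-- k′-colouring g with k‖g‖ ≤ k′‖f‖; a minimum-weight k′-function exists by
-- exhaustive search, since all the conditions are decidable.
--
-- If a,b ≥ 2k then γ_rk(K_{a,b}) =
-- γ_krt(K_{a,b}) = 2k: giving all k colours to one vertex on each side is
-- a k-RTDF of weight 2k; conversely, a side without empty vertices has
-- weight ≥ 2k, and an empty vertex forces all k colours onto the opposite
-- side.

open import Defs hiding (sym)
open import Data.Bool using (Bool; true; false; _xor_)
open import Data.Bool.Properties using (xor-same; ¬-not; T-≡) renaming (_≟_ to _≟ᵇ_)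
open import Data.Empty using (⊥-elim)
open import Data.Fin using (Fin; zero; suc; toℕ; _↑ˡ_; _↑ʳ_; splitAt)
open import Data.Fin.Properties using (any?; all?; toℕ<n; toℕ-↑ˡ; toℕ-↑ʳ; splitAt-↑ˡ; splitAt-↑ʳ; splitAt⁻¹-↑ˡ; splitAt⁻¹-↑ʳ)
open import Data.Fin.Subset using (Subset; _∈_; ⊥; ⊤; ⁅_⁆; ∣_∣)
open import Data.Fin.Subset.Properties using (_∈?_; anySubset?; nonempty?; Empty-unique; x∈p⇒∣p-x∣<∣p∣; ∣⊤∣≡n; ∣⊥∣≡0; ∈⊤)
import Data.List as List
open import Data.List.Properties using (map-tabulate)
import Data.Nat.ListAction as ListAction
open import Data.Nat using (ℕ; zero; suc; _+_; _*_; _≤_; _<_; _<ᵇ_; _≤′_; ≤′-refl; ≤′-step; s≤s; z≤n; NonZero; _≤?_; _<?_)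
open import Data.Nat.Induction using (<-wellFounded)
open import Data.Nat.Properties
open import Data.Product using (Σ; ∃; _×_; _,_; proj₁)
open import Data.Sum using (inj₁; inj₂; [_,_]′)
open import Data.Vec using ([]; _∷_; head; tail; lookup; here; there)
open import Data.Vec.Properties using ([]=⇒lookup; lookup-replicate; ≡-dec)
import Data.Vec.Functional as Vector
open import Function using (_∘_; id; Equivalence)
open import Induction.WellFounded using (Acc; acc)
open import Relation.Binary.PropositionalEquality
  using (_≡_; _≢_; _≗_; refl; sym; trans; cong; cong₂; subst; module ≡-Reasoning)
open import Relation.Nullary using (Dec; yes; no; ¬_; contradiction)
open import Relation.Nullary.Decidable using (map′; _×-dec_; _→-dec_)
open import Relation.Unary using (Decidable)
open import Algebra.Properties.CommutativeMonoid.Sum +-0-commutativeMonoid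
  using (sum; sum-syntax; sum-cong-≗; sum-replicate-zero; ∑-distrib-+; ∑-comm)
open import Algebra.Properties.CommutativeSemigroup *-commutativeSemigroup
  using (x∙yz≈y∙xz)

list-sum-tabulate : ∀ {n} (g : Fin n → ℕ) → ListAction.sum (List.tabulate g) ≡ sum g
list-sum-tabulate {zero}  g = refl
list-sum-tabulate {suc n} g = cong (g zero +_) (list-sum-tabulate (g ∘ suc))

weight-as-sum : ∀ G k (f : Assignment G k) → weight G k f ≡ ∑[ v < n G ] ∣ f v ∣
weight-as-sum G k f =
  trans (cong ListAction.sum (map-tabulate id (λ v → ∣ f v ∣))) (list-sum-tabulate (λ v → ∣ f v ∣))

∑-mono : ∀ {n} {g h : Fin n → ℕ} → (∀ i → g i ≤ h i) → sum g ≤ sum h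
∑-mono {zero}  g≤h = z≤n
∑-mono {suc n} g≤h = +-mono-≤ (g≤h zero) (∑-mono (g≤h ∘ suc))

term≤∑ : ∀ {n} (g : Fin n → ℕ) i → g i ≤ sum g
term≤∑ g zero    = m≤m+n (g zero) _
term≤∑ g (suc i) = ≤-trans (term≤∑ (g ∘ suc) i) (m≤n+m _ (g zero))

∑-const-1 : ∀ n → ∑[ i < n ] 1 ≡ n
∑-const-1 zero    = refl
∑-const-1 (suc n) = cong suc (∑-const-1 n)

∑-split : ∀ m {n} (g : Fin (m + n) → ℕ)
        → sum g ≡ ∑[ i < m ] g (i ↑ˡ n) + ∑[ j < n ] g (m ↑ʳ j)
∑-split zero    g = refl
∑-split (suc m) g = trans (cong (g zero +_) (∑-split m (g ∘ suc))) (sym (+-assoc (g zero) _ _))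

pigeonhole : ∀ k (g : Fin (suc k) → ℕ) → ∃ λ c → suc k * g c ≤ sum g
pigeonhole zero    g = zero , ≤-refl
pigeonhole (suc k) g with pigeonhole k (g ∘ suc)
... | c , kc≤rest with g zero ≤? g (suc c)
...   | yes g₀≤gc = zero , +-monoʳ-≤ (g zero) (≤-trans (*-monoʳ-≤ (suc k) g₀≤gc) kc≤rest)
...   | no  g₀≰gc = suc c , +-mono-≤ (<⇒≤ (≰⇒> g₀≰gc)) kc≤rest

⟦_⟧ : Bool → ℕ
⟦ true ⟧  = 1
⟦ false ⟧ = 0

size-cons : ∀ {k} x (S : Subset k) → ∣ x ∷ S ∣ ≡ ⟦ x ⟧ + ∣ S ∣
size-cons true  S = refl
size-cons false S = refl

size-by-colour : ∀ {k} (S : Subset k) → ∣ S ∣ ≡ ∑[ c < k ] ⟦ lookup S c ⟧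
size-by-colour []      = refl
size-by-colour (x ∷ S) = trans (size-cons x S) (cong (⟦ x ⟧ +_) (size-by-colour S))

member-counts : ∀ {k} {S : Subset k} {c} → c ∈ S → ⟦ lookup S c ⟧ ≡ 1
member-counts c∈S = cong ⟦_⟧ ([]=⇒lookup c∈S)

double-count : ∀ {m k} (S : Fin m → Subset k)
             → ∑[ u < m ] ∣ S u ∣ ≡ ∑[ c < k ] ∑[ u < m ] ⟦ lookup (S u) c ⟧
double-count S = trans (sum-cong-≗ (size-by-colour ∘ S)) (∑-comm (λ u c → ⟦ lookup (S u) c ⟧))

covering-bound : ∀ {m k} (S : Fin m → Subset k) → (∀ c → ∃ λ u → c ∈ S u)
               → k ≤ ∑[ u < m ] ∣ S u ∣
covering-bound {m} {k} S covers = begin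
  k                                               ≡⟨ sym (∑-const-1 k) ⟩
  ∑[ c < k ] 1                                    ≤⟨ ∑-mono occurs ⟩
  ∑[ c < k ] ∑[ u < m ] ⟦ lookup (S u) c ⟧        ≡⟨ sym (double-count S) ⟩
  ∑[ u < m ] ∣ S u ∣                              ∎
  where
  open ≤-Reasoning
  occurs : ∀ c → 1 ≤ ∑[ u < m ] ⟦ lookup (S u) c ⟧
  occurs c with covers c
  ... | u , c∈Su = subst (_≤ _) (member-counts c∈Su) (term≤∑ (λ u → ⟦ lookup (S u) c ⟧) u)

nonempty-size : ∀ {k} {S : Subset k} → S ≢ ⊥ → 1 ≤ ∣ S ∣
nonempty-size {S = S} S≢⊥ with nonempty? S
... | yes (x , x∈S) = ≤-trans (s≤s z≤n) (x∈p⇒∣p-x∣<∣p∣ x∈S)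
... | no  empty     = contradiction (Empty-unique empty) S≢⊥

nonempty-bound : ∀ {m k} (S : Fin m → Subset k) → (∀ u → S u ≢ ⊥) → m ≤ ∑[ u < m ] ∣ S u ∣
nonempty-bound {m} S nonempty = ≤-trans (≤-reflexive (sym (∑-const-1 m))) (∑-mono (nonempty-size ∘ nonempty))

-- Every condition in sight is decidable, and
-- assignments range over a finite set, so a lighter valid assignment can
-- be searched for; well-founded descent on the weight ends at a minimum.

Searchable : Set → Set₁
Searchable A = ∀ {Q : A → Set} → Decidable Q → Dec (∃ Q)

search-functions : ∀ {A : Set} → Searchable A → ∀ n {Q : (Fin n → A) → Set}
                 → (∀ {f g} → f ≗ g → Q f → Q g) → Decidable Q → Dec (∃ Q)
search-functions search-A zero Q-ext Q? =
  map′ (λ q → Vector.[] , q) (λ (f , q) → Q-ext (λ ()) q) (Q? Vector.[])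
search-functions search-A (suc n) Q-ext Q? =
  map′ (λ (x , g , q) → x Vector.∷ g , q)
       (λ (f , q) → Vector.head f , Vector.tail f , Q-ext (λ { zero → refl ; (suc i) → refl }) q)
       (search-A λ x → search-functions search-A n
          (λ f≗g → Q-ext λ { zero → refl ; (suc i) → f≗g i })
          (λ g → Q? (x Vector.∷ g)))

weight-cong : ∀ G k {f g : Assignment G k} → f ≗ g → weight G k f ≡ weight G k g
weight-cong G k {f} {g} f≗g = begin
  weight G k f            ≡⟨ weight-as-sum G k f ⟩
  ∑[ v < n G ] ∣ f v ∣     ≡⟨ sum-cong-≗ (cong ∣_∣ ∘ f≗g) ⟩
  ∑[ v < n G ] ∣ g v ∣     ≡⟨ sym (weight-as-sum G k g) ⟩
  weight G k g            ∎
  where open ≡-Reasoning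

minimum-exists : ∀ G k (P : Assignment G k → Set) → Decidable P
               → (∀ {f g} → f ≗ g → P f → P g)
               → ∀ f → P f → ∃ (IsMinWeight G k P)
minimum-exists G k P P? P-ext f Pf = descend f Pf (<-wellFounded (weight G k f))
  where
  lighter? : ∀ w → Dec (∃ λ g → P g × weight G k g < w)
  lighter? w = search-functions anySubset? (n G)
    (λ f≗g (Pf , f<w) → P-ext f≗g Pf , subst (_< w) (weight-cong G k f≗g) f<w)
    (λ g → P? g ×-dec (weight G k g <? w))
  descend : ∀ f → P f → Acc _<_ (weight G k f) → ∃ (IsMinWeight G k P)
  descend f Pf (acc lighter-acc) with lighter? (weight G k f)
  ... | yes (g , Pg , g<f) = descend g Pg (lighter-acc g<f)
  ... | no  none           = weight G k f , (f , Pf , refl) , λ g Pg → ≮⇒≥ (λ g<f → none (g , Pg , g<f))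

_≟ˢ_ : ∀ {k} (S T : Subset k) → Dec (S ≡ T)
_≟ˢ_ = ≡-dec _≟ᵇ_

IsRDF? : ∀ G k → Decidable (IsRDF G k)
IsRDF? G k f =
  all? λ v → (f v ≟ˢ ⊥) →-dec all? λ i → any? λ u → (adj G v u ≟ᵇ true) ×-dec (i ∈? f u)

IsRTDF? : ∀ G k → Decidable (IsRTDF G k)
IsRTDF? G k f = IsRDF? G k f ×-dec
  (all? λ v → all? λ i → (f v ≟ˢ ⁅ i ⁆) →-dec any? λ u → (adj G v u ≟ᵇ true) ×-dec (i ∈? f u))

IsRDF-cong : ∀ G k {f g : Assignment G k} → f ≗ g → IsRDF G k f → IsRDF G k g
IsRDF-cong G k f≗g rdf v gv≡⊥ i with rdf v (trans (f≗g v) gv≡⊥) i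
... | u , v~u , i∈fu = u , v~u , subst (i ∈_) (f≗g u) i∈fu

IsRTDF-cong : ∀ G k {f g : Assignment G k} → f ≗ g → IsRTDF G k f → IsRTDF G k g
IsRTDF-cong G k {f} {g} f≗g (rdf , total) = IsRDF-cong G k f≗g rdf , singleton
  where
  singleton : ∀ v i → g v ≡ ⁅ i ⁆ → ∃ λ u → (G ~[ v ] u) × (i ∈ g u)
  singleton v i gv≡⁅i⁆ with total v i (trans (f≗g v) gv≡⁅i⁆)
  ... | u , v~u , i∈fu = u , v~u , subst (i ∈_) (f≗g u) i∈fu

-- Adding a colour.  The new colour (index 0) is given to exactly the
-- vertices carrying the old colour c.

addColour : ∀ {k} → Subset k → Fin k → Subset (suc k)
addColour S c = lookup S c ∷ S

extend : ∀ G {k} → Assignment G k → Fin k → Assignment G (suc k)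
extend G f c v = addColour (f v) c

new-colour-∈ : ∀ {k} {S : Subset k} {c} → c ∈ S → zero ∈ addColour S c
new-colour-∈ {S = S} c∈S = subst (λ x → zero ∈ (x ∷ S)) (sym ([]=⇒lookup c∈S)) here

-- Domination is preserved: a vertex that needs colour 0 finds it on the
-- neighbour that supplies c.
extend-RDF : ∀ G k f c → IsRDF G k f → IsRDF G (suc k) (extend G f c)
extend-RDF G k f c rdf v e zero with rdf v (cong tail e) c
... | u , v~u , c∈fu = u , v~u , new-colour-∈ c∈fu
extend-RDF G k f c rdf v e (suc i) with rdf v (cong tail e) i
... | u , v~u , i∈fu = u , v~u , there i∈fu

-- Total domination is preserved as well: a singleton label {0} cannot
-- arise, as it would need c in an empty old label.
extend-RTDF : ∀ G k f c → IsRTDF G k f → IsRTDF G (suc k) (extend G f c)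
extend-RTDF G k f c (rdf , total) = extend-RDF G k f c rdf , singleton
  where
  singleton : ∀ v i → extend G f c v ≡ ⁅ i ⁆ → ∃ λ u → (G ~[ v ] u) × (i ∈ extend G f c u)
  singleton v zero e = contradiction (trans (sym c∉⊥) (cong head e)) λ ()
    where
    c∉⊥ : lookup (f v) c ≡ false
    c∉⊥ = trans (cong (λ S → lookup S c) (cong tail e)) (lookup-replicate c false)
  singleton v (suc i) e with total v i (cong tail e)
  ... | u , v~u , i∈fu = u , v~u , there i∈fu

uses : ∀ G {k} → Assignment G k → Fin k → ℕ
uses G f c = ∑[ v < n G ] ⟦ lookup (f v) c ⟧

weight-by-colour : ∀ G k (f : Assignment G k) → ∑[ c < k ] uses G f c ≡ weight G k f
weight-by-colour G k f = trans (sym (double-count f)) (sym (weight-as-sum G k f))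

weight-extend : ∀ G k (f : Assignment G k) c → weight G (suc k) (extend G f c) ≡ uses G f c + weight G k f
weight-extend G k f c = begin
  weight G (suc k) (extend G f c)               ≡⟨ weight-as-sum G (suc k) (extend G f c) ⟩
  ∑[ v < n G ] ∣ addColour (f v) c ∣             ≡⟨ sum-cong-≗ (λ v → size-cons (lookup (f v) c) (f v)) ⟩
  ∑[ v < n G ] (⟦ lookup (f v) c ⟧ + ∣ f v ∣)    ≡⟨ ∑-distrib-+ (λ v → ⟦ lookup (f v) c ⟧) (λ v → ∣ f v ∣) ⟩
  uses G f c + ∑[ v < n G ] ∣ f v ∣               ≡⟨ cong (uses G f c +_) (sym (weight-as-sum G k f)) ⟩
  uses G f c + weight G k f                      ∎
  where open ≡-Reasoning

cheap-extension : ∀ G k (f : Assignment G (suc k)) → ∃ λ c →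
                  suc k * weight G (suc (suc k)) (extend G f c) ≤ suc (suc k) * weight G (suc k) f
cheap-extension G k f with pigeonhole k (uses G f)
... | c , few-uses = c , (begin
  suc k * weight G (suc (suc k)) (extend G f c)  ≡⟨ cong (suc k *_) (weight-extend G (suc k) f c) ⟩
  suc k * (uses G f c + W)                      ≡⟨ *-distribˡ-+ (suc k) (uses G f c) W ⟩
  suc k * uses G f c + suc k * W                ≤⟨ +-monoˡ-≤ (suc k * W) few-uses ⟩
  ∑[ c < suc k ] uses G f c + suc k * W          ≡⟨ cong (_+ suc k * W) (weight-by-colour G (suc k) f) ⟩
  W + suc k * W                                 ∎)
  where
  open ≤-Reasoning
  W : ℕ
  W = weight G (suc k) f

ratio-trans : ∀ a b c {x y z} .{{_ : NonZero b}} → a * y ≤ b * x → b * z ≤ c * y → a * z ≤ c * x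
ratio-trans a b c {x} {y} {z} ay≤bx bz≤cy = *-cancelˡ-≤ b (begin
  b * (a * z)  ≡⟨ x∙yz≈y∙xz b a z ⟩
  a * (b * z)  ≤⟨ *-monoʳ-≤ a bz≤cy ⟩
  a * (c * y)  ≡⟨ x∙yz≈y∙xz a c y ⟩
  c * (a * y)  ≤⟨ *-monoʳ-≤ c ay≤bx ⟩
  c * (b * x)  ≡⟨ x∙yz≈y∙xz c b x ⟩
  b * (c * x)  ∎)
  where open ≤-Reasoning

record ExtensibleProperty (G : Graph) : Set₁ where
  field
    Holds        : ∀ k → Assignment G k → Set
    holds?       : ∀ k → Decidable (Holds k)
    holds-cong   : ∀ k {f g : Assignment G k} → f ≗ g → Holds k f → Holds k g
    holds-extend : ∀ k f c → Holds k f → Holds (suc k) (extend G f c)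

rainbow : ∀ G → ExtensibleProperty G
rainbow G = record
  { Holds = IsRDF G ; holds? = IsRDF? G ; holds-cong = IsRDF-cong G ; holds-extend = extend-RDF G }

totalRainbow : ∀ G → ExtensibleProperty G
totalRainbow G = record
  { Holds = IsRTDF G ; holds? = IsRTDF? G ; holds-cong = IsRTDF-cong G ; holds-extend = extend-RTDF G }

module _ {G : Graph} (P : ExtensibleProperty G) where
  open ExtensibleProperty P

  stretch : ∀ {k k′} → k ≤′ k′ → ∀ (f : Assignment G (suc k)) → Holds (suc k) f
          → ∃ λ g → Holds (suc k′) g × suc k * weight G (suc k′) g ≤ suc k′ * weight G (suc k) f
  stretch ≤′-refl      f Hf = f , Hf , ≤-refl
  stretch {k} (≤′-step {k′} k≤k′) f Hf with stretch k≤k′ f Hf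
  ... | g , Hg , g-bound with cheap-extension G k′ g
  ...   | c , c-bound =
    extend G g c , holds-extend (suc k′) g c Hg , ratio-trans (suc k) (suc k′) (suc (suc k′)) g-bound c-bound

  ratio-bound : ∀ {k k′} → 1 ≤ k → k ≤ k′ → ∀ m → IsMinWeight G k (Holds k) m
              → ∃ λ m′ → IsMinWeight G k′ (Holds k′) m′ × k * m′ ≤ k′ * m
  ratio-bound {suc k} {suc k′} _ (s≤s k≤k′) m ((f , Hf , ‖f‖≡m) , _)
    with stretch (≤⇒≤′ k≤k′) f Hf
  ... | g , Hg , g-bound with minimum-exists G (suc k′) (Holds (suc k′)) (holds? _) (holds-cong _) g Hg
  ...   | m′ , min′@(_ , m′-least) = m′ , min′ , (begin
    suc k * m′                   ≤⟨ *-monoʳ-≤ (suc k) (m′-least g Hg) ⟩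
    suc k * weight G (suc k′) g  ≤⟨ g-bound ⟩
    suc k′ * weight G (suc k) f  ≡⟨ cong (suc k′ *_) ‖f‖≡m ⟩
    suc k′ * m                   ∎)
    where open ≤-Reasoning

k+k≡2*k : ∀ k → k + k ≡ 2 * k
k+k≡2*k k = cong (k +_) (sym (+-identityʳ k))

module CompleteBipartite (a′ b′ : ℕ) where
  a : ℕ
  a = suc a′

  b : ℕ
  b = suc b′

  Kab : Graph
  Kab = K a b

  left : Fin a → Fin (a + b)
  left i = i ↑ˡ b

  right : Fin b → Fin (a + b)
  right j = a ↑ʳ j

  onLeft : Fin (a + b) → Bool
  onLeft u = toℕ u <ᵇ a

  onLeft-left : ∀ i → onLeft (left i) ≡ true
  onLeft-left i = trans (cong (_<ᵇ a) (toℕ-↑ˡ i b)) (Equivalence.to T-≡ (<⇒<ᵇ (toℕ<n i)))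

  onLeft-right : ∀ j → onLeft (right j) ≡ false
  onLeft-right j = ¬-not λ a+j<a → ≤⇒≯ (m≤m+n a (toℕ j))
    (subst (_< a) (toℕ-↑ʳ a j) (<ᵇ⇒< _ a (Equivalence.from T-≡ a+j<a)))

  left-right-adjacent : ∀ i j → Kab ~[ left i ] right j
  left-right-adjacent i j = cong₂ _xor_ (onLeft-left i) (onLeft-right j)

  right-left-adjacent : ∀ j i → Kab ~[ right j ] left i
  right-left-adjacent j i = cong₂ _xor_ (onLeft-right j) (onLeft-left i)

  same-side-not-adjacent : ∀ u w → onLeft u ≡ onLeft w → ¬ (Kab ~[ u ] w)
  same-side-not-adjacent u w same u~w =
    contradiction (trans (sym (xor-same (onLeft w))) (trans (cong (_xor onLeft w) (sym same)) u~w)) λ ()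

  neighbour-of-left : ∀ i u → Kab ~[ left i ] u → ∃ λ j → right j ≡ u
  neighbour-of-left i u i~u with splitAt a u in split
  ... | inj₂ j = j , splitAt⁻¹-↑ʳ {i = u} split
  ... | inj₁ j = ⊥-elim (same-side-not-adjacent (left i) (left j)
                   (trans (onLeft-left i) (sym (onLeft-left j)))
                   (subst (Kab ~[ left i ]_) (sym (splitAt⁻¹-↑ˡ {i = u} split)) i~u))

  neighbour-of-right : ∀ j u → Kab ~[ right j ] u → ∃ λ i → left i ≡ u
  neighbour-of-right j u j~u with splitAt a u in split
  ... | inj₁ i = i , splitAt⁻¹-↑ˡ {i = u} split
  ... | inj₂ i = ⊥-elim (same-side-not-adjacent (right j) (right i)
                   (trans (onLeft-right j) (sym (onLeft-right i)))
                   (subst (Kab ~[ right j ]_) (sym (splitAt⁻¹-↑ʳ {i = u} split)) j~u))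

  leftWeight : ∀ {k} → Assignment Kab k → ℕ
  leftWeight f = ∑[ i < a ] ∣ f (left i) ∣

  rightWeight : ∀ {k} → Assignment Kab k → ℕ
  rightWeight f = ∑[ j < b ] ∣ f (right j) ∣

  weight-split : ∀ k (f : Assignment Kab k) → weight Kab k f ≡ leftWeight f + rightWeight f
  weight-split k f = trans (weight-as-sum Kab k f) (∑-split a (λ u → ∣ f u ∣))

  -- An empty vertex sees only the opposite side, so all k colours occur there.
  empty-left-fills-right : ∀ {k} {f : Assignment Kab k} {i} → IsRDF Kab k f → f (left i) ≡ ⊥
                         → k ≤ rightWeight f
  empty-left-fills-right {f = f} {i} rdf empty = covering-bound (f ∘ right) colour-on-right
    where
    colour-on-right : ∀ c → ∃ λ j → c ∈ f (right j)
    colour-on-right c with rdf (left i) empty c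
    ... | u , i~u , c∈fu with neighbour-of-left i u i~u
    ...   | j , right-j≡u = j , subst (λ w → c ∈ f w) (sym right-j≡u) c∈fu

  empty-right-fills-left : ∀ {k} {f : Assignment Kab k} {j} → IsRDF Kab k f → f (right j) ≡ ⊥
                         → k ≤ leftWeight f
  empty-right-fills-left {f = f} {j} rdf empty = covering-bound (f ∘ left) colour-on-left
    where
    colour-on-left : ∀ c → ∃ λ i → c ∈ f (left i)
    colour-on-left c with rdf (right j) empty c
    ... | u , j~u , c∈fu with neighbour-of-right j u j~u
    ...   | i , left-i≡u = i , subst (λ w → c ∈ f w) (sym left-i≡u) c∈fu

  -- Either some side has no empty vertex (and so weight ≥ its size ≥ 2k),
  -- or both sides have an empty vertex (and each side carries ≥ k colours).
  rainbow-lower-bound : ∀ {k} → 2 * k ≤ a → 2 * k ≤ b → ∀ f → IsRDF Kab k f → 2 * k ≤ weight Kab k f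
  rainbow-lower-bound {k} 2k≤a 2k≤b f rdf = ≤-trans split-bound (≤-reflexive (sym (weight-split k f)))
    where
    split-bound : 2 * k ≤ leftWeight f + rightWeight f
    split-bound with any? (λ i → f (left i) ≟ˢ ⊥) | any? (λ j → f (right j) ≟ˢ ⊥)
    ... | no no-empty-left | _ =
      ≤-trans 2k≤a (≤-trans (nonempty-bound (f ∘ left) (λ i e → no-empty-left (i , e)))
                            (m≤m+n (leftWeight f) (rightWeight f)))
    ... | yes _ | no no-empty-right =
      ≤-trans 2k≤b (≤-trans (nonempty-bound (f ∘ right) (λ j e → no-empty-right (j , e)))
                            (m≤n+m (rightWeight f) (leftWeight f)))
    ... | yes (i , empty-i) | yes (j , empty-j) =
      subst (_≤ leftWeight f + rightWeight f) (k+k≡2*k k)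
        (+-mono-≤ (empty-right-fills-left rdf empty-j) (empty-left-fills-right rdf empty-i))

  atFirst : ∀ {m k} → Fin m → Subset k
  atFirst zero    = ⊤
  atFirst (suc _) = ⊥

  atFirst-weight : ∀ m k → ∑[ i < m ] ∣ atFirst {k = k} i ∣ ≤ k
  atFirst-weight zero    k = z≤n
  atFirst-weight (suc m) k = ≤-reflexive (begin
    ∣ ⊤ {k} ∣ + ∑[ i < m ] ∣ ⊥ {k} ∣  ≡⟨ cong₂ _+_ (∣⊤∣≡n k) (sum-cong-≗ {m} λ _ → ∣⊥∣≡0 k) ⟩
    k + ∑[ i < m ] 0                 ≡⟨ cong (k +_) (sum-replicate-zero m) ⟩
    k + 0                            ≡⟨ +-identityʳ k ⟩
    k                                ∎)
    where open ≡-Reasoning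

  corners : ∀ {k} → Assignment Kab k
  corners u = [ atFirst , atFirst ]′ (splitAt a u)

  corners-left : ∀ {k} i → corners {k} (left i) ≡ atFirst i
  corners-left i = cong [ atFirst , atFirst ]′ (splitAt-↑ˡ a i b)

  corners-right : ∀ {k} j → corners {k} (right j) ≡ atFirst j
  corners-right j = cong [ atFirst , atFirst ]′ (splitAt-↑ʳ a b j)

  corners-weight : ∀ k → weight Kab k corners ≤ 2 * k
  corners-weight k = begin
    weight Kab k (corners {k})                              ≡⟨ weight-split k corners ⟩
    leftWeight (corners {k}) + rightWeight (corners {k})    ≡⟨ cong₂ _+_ (sum-cong-≗ (cong ∣_∣ ∘ corners-left {k}))
                                                                          (sum-cong-≗ (cong ∣_∣ ∘ corners-right {k})) ⟩
    ∑[ i < a ] ∣ atFirst {k = k} i ∣ + ∑[ j < b ] ∣ atFirst {k = k} j ∣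
                                                            ≤⟨ +-mono-≤ (atFirst-weight a k) (atFirst-weight b k) ⟩
    k + k                                                   ≡⟨ k+k≡2*k k ⟩
    2 * k                                                   ∎
    where open ≤-Reasoning

  sees-full-corner : ∀ {k} u → ∃ λ w → (Kab ~[ u ] w) × corners {k} w ≡ ⊤
  sees-full-corner u with splitAt a u in split
  ... | inj₁ i = right zero
               , subst (λ x → Kab ~[ x ] right zero) (splitAt⁻¹-↑ˡ {i = u} split) (left-right-adjacent i zero)
               , corners-right zero
  ... | inj₂ j = left zero
               , subst (λ x → Kab ~[ x ] left zero) (splitAt⁻¹-↑ʳ {i = u} split) (right-left-adjacent j zero)
               , corners-left zero

  corners-RTDF : ∀ {k} → IsRTDF Kab k corners
  corners-RTDF = (λ v _ → colour-nearby v) , (λ v i _ → colour-nearby v i)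
    where
    colour-nearby : ∀ {k} v (c : Fin k) → ∃ λ u → (Kab ~[ v ] u) × (c ∈ corners u)
    colour-nearby v c with sees-full-corner v
    ... | u , v~u , full = u , v~u , subst (c ∈_) (sym full) ∈⊤

  rainbow-numbers : ∀ {k} → 2 * k ≤ a → 2 * k ≤ b
                  → IsRainbowDomNumber Kab k (2 * k) × IsRainbowTotalDomNumber Kab k (2 * k)
  rainbow-numbers {k} 2k≤a 2k≤b =
    ((corners , proj₁ corners-RTDF , exact) , lower) ,
    ((corners , corners-RTDF , exact) , λ f → lower f ∘ proj₁)
    where
    lower : ∀ f → IsRDF Kab k f → 2 * k ≤ weight Kab k f
    lower = rainbow-lower-bound 2k≤a 2k≤b
    exact : weight Kab k corners ≡ 2 * k
    exact = ≤-antisym (corners-weight k) (lower corners (proj₁ corners-RTDF))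

-- The hypotheses force both sides of K_{a,b} to be nonempty.
bipartite-numbers : ∀ a b k → 1 ≤ k → 2 * k ≤ a → 2 * k ≤ b
                  → IsRainbowDomNumber (K a b) k (2 * k) × IsRainbowTotalDomNumber (K a b) k (2 * k)
bipartite-numbers (suc a′) (suc b′) k _ = CompleteBipartite.rainbow-numbers a′ b′
bipartite-numbers zero     b        (suc k) _ () _
bipartite-numbers (suc a′) zero     (suc k) _ _ ()

-- Both ratio bounds come from ratio-bound; for K_{a,b} with a, b ≥ 2k′ the
-- numbers are 2k and 2k′, which attain them.
proposition4 : (k k′ : ℕ) → 1 ≤ k → k ≤ k′
    → ((G : Graph)
        → ((m : ℕ) → IsRainbowTotalDomNumber G k m
            → Σ ℕ λ m′ → IsRainbowTotalDomNumber G k′ m′ × k * m′ ≤ k′ * m)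
        × ((m : ℕ) → IsRainbowDomNumber G k m
            → Σ ℕ λ m′ → IsRainbowDomNumber G k′ m′ × k * m′ ≤ k′ * m))
    × ((a b : ℕ) → 2 * k′ ≤ a → 2 * k′ ≤ b
        → (Σ ℕ λ m → Σ ℕ λ m′ → IsRainbowTotalDomNumber (K a b) k m
              × IsRainbowTotalDomNumber (K a b) k′ m′ × k * m′ ≡ k′ * m)
        × (Σ ℕ λ m → Σ ℕ λ m′ → IsRainbowDomNumber (K a b) k m
              × IsRainbowDomNumber (K a b) k′ m′ × k * m′ ≡ k′ * m))
proposition4 k k′ 1≤k k≤k′ =
  (λ G → ratio-bound (totalRainbow G) 1≤k k≤k′ , ratio-bound (rainbow G) 1≤k k≤k′) ,
  λ a b 2k′≤a 2k′≤b →
    let (γr , γrt)   = bipartite-numbers a b k 1≤k (≤-trans 2k≤2k′ 2k′≤a) (≤-trans 2k≤2k′ 2k′≤b)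
        (γr′ , γrt′) = bipartite-numbers a b k′ (≤-trans 1≤k k≤k′) 2k′≤a 2k′≤b
    in (2 * k , 2 * k′ , γrt , γrt′ , same-ratio) , (2 * k , 2 * k′ , γr , γr′ , same-ratio)
  where
  2k≤2k′ : 2 * k ≤ 2 * k′
  2k≤2k′ = *-monoʳ-≤ 2 k≤k′

  same-ratio : k * (2 * k′) ≡ k′ * (2 * k)
  same-ratio = begin
    k * (2 * k′)   ≡⟨ x∙yz≈y∙xz k 2 k′ ⟩
    2 * (k * k′)   ≡⟨ cong (2 *_) (*-comm k k′) ⟩
    2 * (k′ * k)   ≡⟨ x∙yz≈y∙xz k′ 2 k ⟨
    k′ * (2 * k)   ∎
    where open ≡-Reasoning
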